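{- Let $n\ge3$, $k\ge0$ with $k<n\le 2k$. If $S$ is an independent, non-reversible set in $G_n^k$, then every strict alternating cycle contained in $S$ has size $3$.
   Context: The crown $S_n^k$ is the height-2 poset on $A\cup B$, $A=\{a_1,\dots,a_{n+k}\}$ minimal, $B=\{b_1,\dots,b_{n+k}\}$ maximal, indices cyclic mod $n+k$; $a_i$ is incomparable to $b_j$ iff $j\in\{i,\dots,i+k\}$ (mod $n+k$), otherwise $a_i<b_j$. $\mathrm{Inc}(A,B)$: incomparable pairs $(a,b)\in A\times B$; $G_n^k$: graph on $\mathrm{Inc}(A,B)$ with $(a,b)\sim(x,y)$ iff $a<y$ and $x<b$. $S\subseteq\mathrm{Inc}(A,B)$ is reversible if some linear extension $L$ of $S_n^k$ has $x>y$ in $L$ for all $(x,y)\in S$. An indexed set $\{(x_\alpha,y_\alpha):\alpha\in[m]\}$ of incomparable pairs is an alternating cycle of size $m$ if $x_\alpha\le y_{\alpha-1}$ for all $\alpha$ (indices cyclic mod $m$); it is strict if $x_\alpha\le y_\beta$ iff $\beta=\alpha-1$. -}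

module Defs where

open import Data.Nat using (ℕ; zero; suc; _+_; _*_; _∸_; _≤_; _<_; _≤ᵇ_)
open import Data.Bool using (if_then_else_)
open import Data.Fin using (Fin; toℕ; fromℕ; inject₁)
import Data.Fin as F
open import Data.Sum using (_⊎_; inj₁; inj₂)
open import Data.Product using (_×_; _,_; Σ; ∃)
open import Relation.Nullary using (¬_)
open import Relation.Binary.PropositionalEquality using (_≡_)
open import Function.Definitions using (Injective)

-- The crown S_n^k.  Both A and B are indexed by Fin (n + k); indices are cyclic mod n + k.
module Crown (n k : ℕ) where

  N : ℕ
  N = n + k

  cdist : Fin N → Fin N → ℕ
  cdist i j = if toℕ i ≤ᵇ toℕ j then toℕ j ∸ toℕ i else (N + toℕ j) ∸ toℕ i

  -- elements of the crown: inj₁ i = a_i (minimal), inj₂ j = b_j (maximal)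
  Elem : Set
  Elem = Fin N ⊎ Fin N

  a : Fin N → Elem
  a = inj₁

  b : Fin N → Elem
  b = inj₂

  -- strict order of S_n^k: a_i < b_j iff j ∉ {i, …, i+k} (mod N); no other strict relations
  data _<P_ : Elem → Elem → Set where
    a<b : ∀ {i j} → k < cdist i j → inj₁ i <P inj₂ j

  _≤P_ : Elem → Elem → Set
  x ≤P y = x ≡ y ⊎ x <P y

  Incomparable : Elem → Elem → Set
  Incomparable x y = ¬ (x ≤P y) × ¬ (y ≤P x)

  Pair : Set
  Pair = Fin N × Fin N

  fst snd : Pair → Elem
  fst (i , j) = a i
  snd (i , j) = b j

  InInc : Pair → Set
  InInc p = Incomparable (fst p) (snd p)

  _⊆Inc : (Pair → Set) → Set
  S ⊆Inc = ∀ p → S p → InInc p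

  Adj : Pair → Pair → Set
  Adj p q = (fst p <P snd q) × (fst q <P snd p)

  Independent : (Pair → Set) → Set
  Independent S = ∀ p q → S p → S q → ¬ Adj p q

  -- a linear extension of S_n^k, given by an injective position map into ℕ
  -- (a strict linear order on the finite set Elem) which extends <P
  record LinearExtension : Set where
    field
      pos       : Elem → ℕ
      injective : Injective _≡_ _≡_ pos
      extends   : ∀ {x y} → x <P y → pos x < pos y

  Reversible : (Pair → Set) → Set
  Reversible S = Σ LinearExtension λ L →
    ∀ p → S p → LinearExtension.pos L (snd p) < LinearExtension.pos L (fst p)

  prev : ∀ {m} → Fin (suc m) → Fin (suc m)
  prev {m} F.zero = fromℕ m
  prev (F.suc i) = inject₁ i

  AlternatingCycle : ∀ {m} → (Fin (suc m) → Pair) → Set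
  AlternatingCycle c =
    (∀ α → InInc (c α)) × (∀ α → fst (c α) ≤P snd (c (prev α)))

  StrictAlternatingCycle : ∀ {m} → (Fin (suc m) → Pair) → Set
  StrictAlternatingCycle c =
    AlternatingCycle c × (∀ α β → fst (c α) ≤P snd (c β) → β ≡ prev α)

-- a_i is incomparable to b_j exactly when j lies in the cyclic window {i, …, i+k}.  Since
-- 2k < n + k, two windows meet in a cyclic interval, so if a_x is incomparable to b_p, b_q, b_r
-- and b_q lies between the others in x's window, every a incomparable to b_p and b_r is
-- incomparable to b_q; a strict alternating cycle of size ≥ 4 violates this.  Size 1
-- contradicts incomparability and size 2 gives two adjacent pairs in G_n^k, contradicting
-- independence.
module Submission where

open import Defs
open import Data.Nat using (ℕ; zero; suc; _+_; _*_; _∸_; _≤_; _<_; _≤ᵇ_)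
open import Data.Nat.Properties
open import Data.Nat.Tactic.RingSolver using (solve-∀)
open import Data.Fin using (Fin; toℕ; #_)
open import Data.Fin.Properties using (toℕ<n)
open import Data.Bool using (true; false)
open import Data.Sum using (_⊎_; inj₁; inj₂)
open import Data.Product using (_×_; _,_; proj₁; proj₂)
open import Data.Empty using (⊥; ⊥-elim)
open import Relation.Nullary using (¬_)
open import Relation.Nullary.Reflects using (ofʸ; ofⁿ)
open import Relation.Binary.PropositionalEquality
  using (_≡_; _≢_; refl; sym; cong₂; subst; module ≡-Reasoning)

CyclicShift : ℕ → ℕ → ℕ → ℕ → Set
CyclicShift N a v b = v + a ≡ b ⊎ v + a ≡ N + b

module _ {N a b c v₁ v₂ v : ℕ} where

  -- The wrap-arounds w are 0 or N; putting them on the left makes the case w = 0 reduce away.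
  wrapped-sum : ∀ w₁ w₂ w → v₁ + a ≡ w₁ + b → v₂ + b ≡ w₂ + c → v + a ≡ w + c →
                w + (v₂ + v₁) ≡ w₁ + (w₂ + v)
  wrapped-sum w₁ w₂ w h₁ h₂ h = +-cancelʳ-≡ (a + b + c) _ _ (begin
    w + (v₂ + v₁) + (a + b + c)    ≡⟨ regroupˡ w v₂ v₁ a b c ⟩
    (v₁ + a) + (v₂ + b) + (w + c)  ≡⟨ cong₂ _+_ (cong₂ _+_ h₁ h₂) (sym h) ⟩
    (w₁ + b) + (w₂ + c) + (v + a)  ≡⟨ regroupʳ w₁ w₂ v a b c ⟩
    w₁ + (w₂ + v) + (a + b + c)    ∎)
    where
    open ≡-Reasoning
    regroupˡ : ∀ w v₂ v₁ a b c → w + (v₂ + v₁) + (a + b + c) ≡ (v₁ + a) + (v₂ + b) + (w + c)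
    regroupˡ = solve-∀
    regroupʳ : ∀ w₁ w₂ v a b c → (w₁ + b) + (w₂ + c) + (v + a) ≡ w₁ + (w₂ + v) + (a + b + c)
    regroupʳ = solve-∀

  shift-compose : v₁ < N → v₂ < N → v < N →
    CyclicShift N a v₁ b → CyclicShift N b v₂ c → CyclicShift N a v c →
    CyclicShift N v₁ v₂ v
  shift-compose _ _ _ (inj₁ h₁) (inj₁ h₂) (inj₁ h) = inj₁ (wrapped-sum 0 0 0 h₁ h₂ h)
  shift-compose _ _ _ (inj₂ h₁) (inj₁ h₂) (inj₁ h) = inj₂ (wrapped-sum N 0 0 h₁ h₂ h)
  shift-compose _ _ _ (inj₁ h₁) (inj₂ h₂) (inj₁ h) = inj₂ (wrapped-sum 0 N 0 h₁ h₂ h)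
  shift-compose v₁<N v₂<N _ (inj₂ h₁) (inj₂ h₂) (inj₁ h) =
    ⊥-elim (<⇒≢ (+-mono-<-≤ v₂<N (≤-trans (<⇒≤ v₁<N) (m≤m+n N v))) (wrapped-sum N N 0 h₁ h₂ h))
  shift-compose _ _ v<N (inj₁ h₁) (inj₁ h₂) (inj₂ h) =
    ⊥-elim (<⇒≢ (<-≤-trans v<N (m≤m+n N (v₂ + v₁))) (sym (wrapped-sum 0 0 N h₁ h₂ h)))
  shift-compose _ _ _ (inj₂ h₁) (inj₁ h₂) (inj₂ h) = inj₁ (+-cancelˡ-≡ N _ _ (wrapped-sum N 0 N h₁ h₂ h))
  shift-compose _ _ _ (inj₁ h₁) (inj₂ h₂) (inj₂ h) = inj₁ (+-cancelˡ-≡ N _ _ (wrapped-sum 0 N N h₁ h₂ h))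
  shift-compose _ _ _ (inj₂ h₁) (inj₂ h₂) (inj₂ h) = inj₂ (+-cancelˡ-≡ N _ _ (wrapped-sum N N N h₁ h₂ h))

private
  summand≤sum : ∀ {e u y} → e + u ≡ y → u ≤ y
  summand≤sum {e} {u} refl = m≤n+m u e

  sums-cancelʳ-≤ : ∀ {m n o p q} → m + o ≡ p → n + o ≡ q → p ≤ q → m ≤ n
  sums-cancelʳ-≤ {m} {n} {o} refl refl = +-cancelʳ-≤ o m n

  wrapped⇒large : ∀ {N k e u y} → k + k < N → e ≤ k → e + u ≡ N + y → k < u
  wrapped⇒large {N} {k} {e} {u} {y} 2k<N e≤k h = +-cancelˡ-< k k u (begin-strict
    k + k  <⟨ 2k<N ⟩
    N      ≤⟨ m≤m+n N y ⟩
    N + y  ≡⟨ sym h ⟩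
    e + u  ≤⟨ +-monoˡ-≤ u e≤k ⟩
    k + u  ∎)
    where open ≤-Reasoning

-- Shifting y₁ ≤ y₂ ≤ y₃ ≤ k back by u modulo N, with 2k < N: if the outer two land in [0, k],
-- so does the middle one.
shifts-convex : ∀ {N k u e₁ e₂ e₃ y₁ y₂ y₃} → k + k < N → e₂ < N →
  y₁ ≤ y₂ → y₂ ≤ y₃ → y₃ ≤ k → e₁ ≤ k → e₃ ≤ k →
  CyclicShift N u e₁ y₁ → CyclicShift N u e₂ y₂ → CyclicShift N u e₃ y₃ → e₂ ≤ k
shifts-convex _ _ _ y₂≤y₃ _ _ e₃≤k (inj₁ _) (inj₁ h₂) (inj₁ h₃) =
  ≤-trans (sums-cancelʳ-≤ h₂ h₃ y₂≤y₃) e₃≤k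
shifts-convex {N} _ _ _ y₂≤y₃ _ _ e₃≤k (inj₂ _) (inj₂ h₂) (inj₂ h₃) =
  ≤-trans (sums-cancelʳ-≤ h₂ h₃ (+-monoʳ-≤ N y₂≤y₃)) e₃≤k
shifts-convex _ e₂<N y₁≤y₂ _ _ _ _ (inj₁ h₁) (inj₂ h₂) _ =
  ⊥-elim (<⇒≢ (+-mono-<-≤ e₂<N (≤-trans (summand≤sum h₁) y₁≤y₂)) h₂)
shifts-convex {N} {y₃ = y₃} 2k<N _ y₁≤y₂ y₂≤y₃ y₃≤k _ e₃≤k (inj₁ h₁) (inj₁ _) (inj₂ h₃) =
  ⊥-elim (<⇒≢ (<-≤-trans (≤-<-trans (+-mono-≤ e₃≤k u≤k) 2k<N) (m≤m+n N y₃)) h₃)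
  where u≤k = ≤-trans (summand≤sum h₁) (≤-trans y₁≤y₂ (≤-trans y₂≤y₃ y₃≤k))
shifts-convex 2k<N _ _ y₂≤y₃ y₃≤k e₁≤k _ (inj₂ h₁) (inj₁ h₂) _ =
  ⊥-elim (<⇒≱ (wrapped⇒large 2k<N e₁≤k h₁) (≤-trans (summand≤sum h₂) (≤-trans y₂≤y₃ y₃≤k)))
shifts-convex 2k<N _ _ _ y₃≤k e₁≤k _ (inj₂ h₁) (inj₂ _) (inj₁ h₃) =
  ⊥-elim (<⇒≱ (wrapped⇒large 2k<N e₁≤k h₁) (≤-trans (summand≤sum h₃) y₃≤k))

Between : ℕ → ℕ → ℕ → Set
Between x y z = (y ≤ x × x ≤ z) ⊎ (z ≤ x × x ≤ y)

some-between : ∀ x y z → Between x y z ⊎ Between y x z ⊎ Between z x y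
some-between x y z with ≤-total x y | ≤-total y z | ≤-total x z
... | inj₁ x≤y | inj₁ y≤z | _        = inj₂ (inj₁ (inj₁ (x≤y , y≤z)))
... | inj₁ x≤y | inj₂ z≤y | inj₁ x≤z = inj₂ (inj₂ (inj₁ (x≤z , z≤y)))
... | inj₁ x≤y | inj₂ _   | inj₂ z≤x = inj₁ (inj₂ (z≤x , x≤y))
... | inj₂ y≤x | _        | inj₁ x≤z = inj₁ (inj₁ (y≤x , x≤z))
... | inj₂ y≤x | inj₁ y≤z | inj₂ z≤x = inj₂ (inj₂ (inj₂ (y≤z , z≤x)))
... | inj₂ y≤x | inj₂ z≤y | inj₂ _   = inj₂ (inj₁ (inj₂ (z≤y , y≤x)))

module _ (n k : ℕ) where
  open Crown n k

  cdist-shift : ∀ i j → cdist i j < N × CyclicShift N (toℕ i) (cdist i j) (toℕ j)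
  cdist-shift i j with toℕ i ≤ᵇ toℕ j | ≤ᵇ-reflects-≤ (toℕ i) (toℕ j)
  ... | true  | ofʸ i≤j = ≤-<-trans (m∸n≤m (toℕ j) (toℕ i)) (toℕ<n j) , inj₁ (m∸n+n≡m i≤j)
  ... | false | ofⁿ i≰j = +-cancelʳ-< (toℕ i) _ N (subst (_< N + toℕ i) (sym sum) (+-monoʳ-< N j<i))
                        , inj₂ sum
    where
    j<i = ≰⇒> i≰j
    sum : N + toℕ j ∸ toℕ i + toℕ i ≡ N + toℕ j
    sum = m∸n+n≡m (≤-trans (<⇒≤ (toℕ<n i)) (m≤m+n N (toℕ j)))

  cdist-compose : ∀ s t j → CyclicShift N (cdist s t) (cdist t j) (cdist s j)
  cdist-compose s t j =
    let st<N , st = cdist-shift s t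
        tj<N , tj = cdist-shift t j
        sj<N , sj = cdist-shift s j
    in shift-compose st<N tj<N sj<N st tj sj

  ≤P⇒<P : ∀ {i j} → a i ≤P b j → a i <P b j
  ≤P⇒<P (inj₁ ())
  ≤P⇒<P (inj₂ i<j) = i<j

  <P⇒far : ∀ {i j} → a i <P b j → k < cdist i j
  <P⇒far (a<b k<d) = k<d

  ≰P⇒near : ∀ {i j} → ¬ (a i ≤P b j) → cdist i j ≤ k
  ≰P⇒near i≰j = ≮⇒≥ (λ k<d → i≰j (inj₂ (a<b k<d)))

  window-convex : k < n → ∀ {s t lo mid hi} →
    Between (cdist s mid) (cdist s lo) (cdist s hi) → cdist s lo ≤ k → cdist s hi ≤ k →
    cdist t lo ≤ k → cdist t hi ≤ k → cdist t mid ≤ k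
  window-convex k<n {s} {t} {lo} {mid} {hi} (inj₁ (lo≤mid , mid≤hi)) _ s-hi t-lo t-hi =
    shifts-convex (+-monoˡ-< k k<n) (proj₁ (cdist-shift t mid)) lo≤mid mid≤hi s-hi t-lo t-hi
      (cdist-compose s t lo) (cdist-compose s t mid) (cdist-compose s t hi)
  window-convex k<n {s} {t} {lo} {mid} {hi} (inj₂ (hi≤mid , mid≤lo)) s-lo _ t-lo t-hi =
    shifts-convex (+-monoˡ-< k k<n) (proj₁ (cdist-shift t mid)) hi≤mid mid≤lo s-lo t-hi t-lo
      (cdist-compose s t hi) (cdist-compose s t mid) (cdist-compose s t lo)

  alternatingCycle₁-impossible : (c : Fin 1 → Pair) → ¬ AlternatingCycle c
  alternatingCycle₁-impossible c (incomparable , alternates) =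
    proj₁ (incomparable (# 0)) (alternates (# 0))

  alternatingCycle₂⇒Adj : (c : Fin 2 → Pair) → AlternatingCycle c → Adj (c (# 0)) (c (# 1))
  alternatingCycle₂⇒Adj c (_ , alternates) = ≤P⇒<P (alternates (# 0)) , ≤P⇒<P (alternates (# 1))

  -- With pairs (a_{x α}, b_{y α}): a_{x 0} is incomparable to b_{y 0}, b_{y 1}, b_{y 2}; if b_{y β}
  -- lies between the other two in the window of x 0, then a_{x (β+1)} is incomparable to the
  -- other two, hence by convexity to b_{y β} as well, although the cycle forces a_{x (β+1)} < b_{y β}.
  strictAlternatingCycle≥4-impossible : k < n → ∀ {m} (c : Fin (4 + m) → Pair) →
    ¬ StrictAlternatingCycle c
  strictAlternatingCycle≥4-impossible k<n {m} c ((_ , alternates) , strict) =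
    middle-excluded (some-between (dist₀ (# 0)) (dist₀ (# 1)) (dist₀ (# 2)))
    where
    x y : Fin (4 + m) → Fin N
    x α = proj₁ (c α)
    y β = proj₂ (c β)
    dist₀ : Fin (4 + m) → ℕ
    dist₀ β = cdist (x (# 0)) (y β)
    near : ∀ α β → β ≢ prev α → cdist (x α) (y β) ≤ k
    near α β β≢α-1 = ≰P⇒near (λ x≤y → β≢α-1 (strict α β x≤y))
    far : ∀ α → k < cdist (x α) (y (prev α))
    far α = <P⇒far (≤P⇒<P (alternates α))
    middle-not-between : ∀ γ lo hi → lo ≢ prev (# 0) → hi ≢ prev (# 0) → lo ≢ prev γ → hi ≢ prev γ →
                         ¬ Between (dist₀ (prev γ)) (dist₀ lo) (dist₀ hi)
    middle-not-between γ lo hi lo≢₀ hi≢₀ lo≢γ hi≢γ between = <⇒≱ (far γ)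
      (window-convex k<n {x (# 0)} {x γ} {y lo} {y (prev γ)} {y hi} between
        (near (# 0) lo lo≢₀) (near (# 0) hi hi≢₀) (near γ lo lo≢γ) (near γ hi hi≢γ))
    middle-excluded : Between (dist₀ (# 0)) (dist₀ (# 1)) (dist₀ (# 2))
                    ⊎ Between (dist₀ (# 1)) (dist₀ (# 0)) (dist₀ (# 2))
                    ⊎ Between (dist₀ (# 2)) (dist₀ (# 0)) (dist₀ (# 1)) → ⊥
    middle-excluded (inj₁ mid₀) =
      middle-not-between (# 1) (# 1) (# 2) (λ ()) (λ ()) (λ ()) (λ ()) mid₀
    middle-excluded (inj₂ (inj₁ mid₁)) =
      middle-not-between (# 2) (# 0) (# 2) (λ ()) (λ ()) (λ ()) (λ ()) mid₁
    middle-excluded (inj₂ (inj₂ mid₂)) =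
      middle-not-between (# 3) (# 0) (# 1) (λ ()) (λ ()) (λ ()) (λ ()) mid₂

proposition5p1 : (n k : ℕ) → 3 ≤ n → k < n → n ≤ 2 * k →
    (S : Crown.Pair n k → Set) → Crown._⊆Inc n k S →
    Crown.Independent n k S → ¬ Crown.Reversible n k S →
    (m : ℕ) (c : Fin (suc m) → Crown.Pair n k) →
    (∀ α → S (c α)) → Crown.StrictAlternatingCycle n k c →
    suc m ≡ 3
proposition5p1 n k _ _ _ _ _ _ _ zero c _ (cycle , _) =
  ⊥-elim (alternatingCycle₁-impossible n k c cycle)
proposition5p1 n k _ _ _ _ _ independent _ (suc zero) c inS (cycle , _) =
  ⊥-elim (independent _ _ (inS (# 0)) (inS (# 1)) (alternatingCycle₂⇒Adj n k c cycle))
proposition5p1 _ _ _ _ _ _ _ _ _ (suc (suc zero)) _ _ _ = refl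
proposition5p1 n k _ k<n _ _ _ _ _ (suc (suc (suc m))) c _ strictCycle =
  ⊥-elim (strictAlternatingCycle≥4-impossible n k k<n c strictCycle)
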